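{- Let $a,b$ be positive integers, let $\mathbf{c}=(c_0,\dots,c_{a-1})\in\mathbb{Z}^a$ with $\sum_i c_i=0$, and index $\mathbf{c}$ cyclically (i.e. $c_j:=c_{r_a(j)}$ for all $j\in\mathbb{Z}$). Then the $a$-core $\mathbf{core}_a(\mathbf{c})$ is also a $b$-core if and only if $$c_{i+b}-c_i\le q_a(b+i)\quad\text{for all } i\in\{0,\dots,a-1\}.$$
   Context: For integers $x$ and $a>0$, $q_a(x)=\lfloor x/a\rfloor$ and $r_a(x)=x-a\,q_a(x)\in\{0,\dots,a-1\}$. A partition $\lambda$ is a nonincreasing sequence $\lambda_1\ge\lambda_2\ge\cdots\ge0$ of integers with finitely many nonzero terms; hook lengths are the usual ones (arm + leg + 1 of a cell of the Young diagram), and a partition is a $b$-core if no cell has hook length $b$. For $\mathbf{c}\in\mathbb{Z}^a$ with $\sum c_i=0$, $\mathbf{core}_a(\mathbf{c})$ is the unique partition $\lambda$ such that $$\{\lambda_j-j+\tfrac12 : j\ge1\}=\bigcup_{i=0}^{a-1}\{ma-i-\tfrac12 : m\in\mathbb{Z},\ m\le -c_i\}.$$ It is standard that $\mathbf{c}\mapsto\mathbf{core}_a(\mathbf{c})$ is a bijection from $\{\mathbf{c}\in\mathbb{Z}^a:\sum c_i=0\}$ onto the set of $a$-cores (partitions with no hook length $a$). -}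

module Defs where

open import Data.Nat as ℕ using (ℕ; zero; suc; _∸_; _≤?_)
open import Data.Integer as ℤ using (ℤ; +_; _-_; _*_; -_; 1ℤ; 0ℤ)
open import Data.Fin using (Fin; toℕ)
open import Data.List using (List; []; _∷_; length; filter)
open import Data.List.Relation.Unary.All using (All)
open import Data.List.Relation.Unary.Linked using (Linked)
open import Data.Product using (Σ; _×_; ∃; ∃-syntax)
open import Relation.Binary.PropositionalEquality using (_≡_)
open import Relation.Nullary using (¬_)
open import Function.Bundles using (_⇔_)

sumℤ : ∀ {n} → (Fin n → ℤ) → ℤ
sumℤ {zero}  c = 0ℤ
sumℤ {suc n} c = c Fin.zero ℤ.+ sumℤ (λ i → c (Fin.suc i))
  where import Data.Fin as Fin

-- A partition is represented by the list (λ₁, λ₂, …, λ_ℓ) of its nonzero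
-- parts, which must be positive and nonincreasing.
IsPartition : List ℕ → Set
IsPartition l = All (λ x → 1 ℕ.≤ x) l × Linked ℕ._≥_ l

-- part l j = λ_j (1-indexed), with λ_j = 0 beyond the length (and for j = 0).
part : List ℕ → ℕ → ℕ
part []       _             = 0
part (x ∷ xs) zero          = 0
part (x ∷ xs) (suc zero)    = x
part (x ∷ xs) (suc (suc j)) = part xs (suc j)

conj : List ℕ → ℕ → ℕ
conj l k = length (filter (λ x → k ≤? x) l)

-- cell (j,k) (row j, column k, 1-indexed) lies in the Young diagram
InDiagram : List ℕ → ℕ → ℕ → Set
InDiagram l j k = (1 ℕ.≤ j) × (1 ℕ.≤ k) × (k ℕ.≤ part l j)

-- hook length of cell (j,k): arm (λ_j - k) + leg (λ'_k - j) + 1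
hook : List ℕ → ℕ → ℕ → ℕ
hook l j k = (part l j ∸ k) ℕ.+ (conj l k ∸ j) ℕ.+ 1

IsCore : ℕ → List ℕ → Set
IsCore b l = ¬ (∃[ j ] ∃[ k ] (InDiagram l j k × hook l j k ≡ b))

-- λ = core_a(c): λ is a partition and
--   { λ_j - j + 1/2 : j ≥ 1 } = ⋃_i { m a - i - 1/2 : m ∈ ℤ, m ≤ -c_i },
-- written after subtracting 1/2 from both sides (so all values are integers):
--   { λ_j - j : j ≥ 1 } = ⋃_i { m a - i - 1 : m ≤ -c_i }.
IsCoreOf : (a : ℕ) → (Fin a → ℤ) → List ℕ → Set
IsCoreOf a c l =
  IsPartition l ×
  ((x : ℤ) →
    (∃[ j ] ((1 ℕ.≤ j) × (x ≡ (+ part l j) - (+ j))))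
    ⇔ (∃[ i ] ∃[ m ] ((m ℤ.≤ - c i) × (x ≡ m * (+ a) - (+ toℕ i) - 1ℤ))))

module Submission where

-- Write β(λ) = { λ_j - j : j ≥ 1 } ⊆ ℤ for the (shifted) beta-set of a partition λ,
-- and say that a set S ⊆ ℤ has a b-gap if some x ∈ S has x - b ∉ S.
--
-- A partition has a cell of hook length
--    b ≥ 1 iff β(λ) has a b-gap.  A cell (j,k) of hook length b makes x = λ_j - j a
--    gap; conversely, for a gap x = λ_j - j, the last row t with λ_t - t > x - b
--    yields the column k = x - b + t + 1, and the cell (j,k) has hook length b.
--    Both directions rest on the Galois connection  k ≤ λ_s ⇔ s ≤ λ'_k
--    between a partition and its conjugate (module Conjugate).
-- 2. Gaps on the abacus (module Abacus).  The set {m a - i - 1 : m ≤ -c_i} has a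
--    b-gap iff c_{i+b} - c_i ≤ q_a(b+i) fails for some runner i: subtracting b moves
--    the bead (i,m) to (r_a(i+b), m - q_a(b+i)), and beads have unique coordinates.
-- 3. The hypothesis λ = core_a(c) says exactly that both sets coincide, so the
--    theorem is the composition of 1 and 2.

open import Defs
open import Data.Nat using (ℕ; NonZero; _/_)

module Gaps where
  open import Data.Integer using (ℤ; +_; _-_)
  open import Data.Product using (∃-syntax; _×_; _,_)
  open import Relation.Nullary using (¬_)
  open import Relation.Nullary.Negation using (contraposition)
  open import Function.Bundles using (_⇔_; mk⇔; Equivalence)

  ¬-cong : ∀ {A B : Set} → A ⇔ B → (¬ A) ⇔ (¬ B)
  ¬-cong A⇔B = mk⇔ (contraposition (Equivalence.from A⇔B)) (contraposition (Equivalence.to A⇔B))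

  HasGap : (ℤ → Set) → ℕ → Set
  HasGap S b = ∃[ x ] (S x × ¬ S (x - + b))

  HasGap-cong : ∀ {S T : ℤ → Set} {b} → (∀ x → S x ⇔ T x) → HasGap S b ⇔ HasGap T b
  HasGap-cong S⇔T = mk⇔
    (λ (x , Sx , ¬Sx-b) → x , Equivalence.to (S⇔T x) Sx , contraposition (Equivalence.from (S⇔T _)) ¬Sx-b)
    (λ (x , Tx , ¬Tx-b) → x , Equivalence.from (S⇔T x) Tx , contraposition (Equivalence.to (S⇔T _)) ¬Tx-b)

module Conjugate where
  open import Data.Nat
  open import Data.Nat.Properties
  open import Data.List using (List; []; _∷_; length)
  open import Data.List.Properties using (filter-accept; filter-none)
  open import Data.List.Relation.Unary.All as All using (All; []; _∷_)
  open import Data.List.Relation.Unary.Linked using (Linked; tail)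
  open import Data.List.Relation.Unary.Linked.Properties using (Linked⇒All)
  open import Relation.Binary.PropositionalEquality
  open import Relation.Nullary using (yes; no; contradiction)
  open import Function.Bundles using (_⇔_; mk⇔; Equivalence)

  Nonincreasing : List ℕ → Set
  Nonincreasing = Linked _≥_

  part-All : ∀ {P : ℕ → Set} {l} → All P l → P 0 → ∀ s → P (part l s)
  part-All []         P0 s             = P0
  part-All (_ ∷ _)    P0 zero          = P0
  part-All (Px ∷ _)   P0 (suc zero)    = Px
  part-All (_ ∷ Pxs)  P0 (suc (suc s)) = part-All Pxs P0 (suc s)

  bounded-by-head : ∀ {x xs} → Nonincreasing (x ∷ xs) → All (_≤ x) (x ∷ xs)
  bounded-by-head = Linked⇒All (λ x≥y y≥z → ≤-trans y≥z x≥y) ≤-refl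

  conj-accept : ∀ {x xs k} → k ≤ x → conj (x ∷ xs) k ≡ suc (conj xs k)
  conj-accept k≤x = cong length (filter-accept (_ ≤?_) k≤x)

  conj-above : ∀ {l x k} → All (_≤ x) l → x < k → conj l k ≡ 0
  conj-above l≤x x<k =
    cong length (filter-none (_ ≤?_) (All.map (λ y≤x k≤y → <⇒≱ x<k (≤-trans k≤y y≤x)) l≤x))

  galois : ∀ {l k} → Nonincreasing l → 1 ≤ k → ∀ s → 1 ≤ s → (k ≤ part l s) ⇔ (s ≤ conj l k)
  galois {[]}     _ (s≤s z≤n) (suc s) _ = mk⇔ (λ ()) (λ ())
  galois {x ∷ xs} {k} l↓ k≥1 (suc s) _ with k ≤? x
  ... | no k≰x rewrite conj-above (bounded-by-head l↓) (≰⇒> k≰x) =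
    mk⇔ (λ k≤λs → contradiction (≤-trans k≤λs (part-All (bounded-by-head l↓) z≤n (suc s))) k≰x) (λ ())
  ... | yes k≤x rewrite conj-accept {xs = xs} k≤x with s
  ...   | zero   = mk⇔ (λ _ → s≤s z≤n) (λ _ → k≤x)
  ...   | suc s′ = mk⇔ (λ k≤λs → s≤s (Equivalence.to ih k≤λs)) (λ s≤λ'k → Equivalence.from ih (s≤s⁻¹ s≤λ'k))
    where
    ih : (k ≤ part xs (suc s′)) ⇔ (suc s′ ≤ conj xs k)
    ih = galois (tail l↓) k≥1 (suc s′) (s≤s z≤n)

  part-antitone : ∀ {l j s} → Nonincreasing l → 1 ≤ j → j ≤ s → part l s ≤ part l j
  part-antitone {l} {j} {s} l↓ j≥1 j≤s with part l s in λs≡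
  ... | zero  = z≤n
  ... | suc p = Equivalence.from (galois l↓ (s≤s z≤n) j j≥1)
                  (≤-trans j≤s (Equivalence.to (galois l↓ (s≤s z≤n) s (≤-trans j≥1 j≤s)) (≤-reflexive (sym λs≡))))

module HooksAndGaps where
  open import Data.Nat
  open import Data.Nat.Properties
  open import Data.Nat.Tactic.RingSolver using (solve-∀)
  open import Data.Integer as ℤ using (ℤ; +_)
  import Data.Integer.Properties as ℤ
  open import Data.Integer.Tactic.RingSolver as ℤ-Solver using ()
  open import Data.List using (List)
  open import Data.Product using (∃-syntax; _×_; _,_)
  open import Relation.Binary.PropositionalEquality
  open import Relation.Nullary using (¬_; yes; no; contradiction)
  open import Relation.Unary using (Decidable)
  open import Function.Bundles using (_⇔_; mk⇔; Equivalence)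
  open Equivalence using (to; from)
  import Function.Properties.Equivalence as ⇔
  open Conjugate
  open Gaps

  Beta : List ℕ → ℤ → Set
  Beta l x = ∃[ j ] ((1 ≤ j) × (x ≡ + part l j ℤ.- + j))

  HasHook : ℕ → List ℕ → Set
  HasHook b l = ∃[ j ] ∃[ k ] (InDiagram l j k × hook l j k ≡ b)

  switch-point : ∀ {P : ℕ → Set} → Decidable P → ∀ s n → P s → ¬ P (s + n) →
                 ∃[ t ] (s ≤ t × t < s + n × P t × ¬ P (suc t))
  switch-point {P} P? s zero    Ps ¬Ps+0 = contradiction (subst P (sym (+-identityʳ s)) Ps) ¬Ps+0
  switch-point {P} P? s (suc n) Ps ¬Ps+n with P? (suc s)
  ... | no ¬Ps+1 = s , ≤-refl , m<m+n s z<s , Ps , ¬Ps+1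
  ... | yes Ps+1 with switch-point P? (suc s) n Ps+1 (subst (λ u → ¬ P u) (+-suc s n) ¬Ps+n)
  ...   | t , s<t , t<s+n , Pt , ¬Pt+1 = t , <⇒≤ s<t , subst (t <_) (sym (+-suc s n)) t<s+n , Pt , ¬Pt+1

  sub≡sub⇔ : ∀ x y z w v → (x ℤ.- y ≡ (z ℤ.- w) ℤ.- v) ⇔ (x ℤ.+ (w ℤ.+ v) ≡ z ℤ.+ y)
  sub≡sub⇔ x y z w v = mk⇔
    (λ eq → begin
      x ℤ.+ (w ℤ.+ v)                          ≡⟨ add-back x y w v ⟩
      (x ℤ.- y) ℤ.+ (y ℤ.+ (w ℤ.+ v))          ≡⟨ cong (ℤ._+ (y ℤ.+ (w ℤ.+ v))) eq ⟩
      ((z ℤ.- w) ℤ.- v) ℤ.+ (y ℤ.+ (w ℤ.+ v))  ≡⟨ cancel z w v y ⟩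
      z ℤ.+ y                                  ∎)
    (λ eq → begin
      x ℤ.- y                                  ≡⟨ take-off x y w v ⟩
      (x ℤ.+ (w ℤ.+ v)) ℤ.- (y ℤ.+ (w ℤ.+ v))  ≡⟨ cong (ℤ._- (y ℤ.+ (w ℤ.+ v))) eq ⟩
      (z ℤ.+ y) ℤ.- (y ℤ.+ (w ℤ.+ v))          ≡⟨ uncancel z y w v ⟩
      (z ℤ.- w) ℤ.- v                          ∎)
    where
    open ≡-Reasoning
    add-back : ∀ x y w v → x ℤ.+ (w ℤ.+ v) ≡ (x ℤ.- y) ℤ.+ (y ℤ.+ (w ℤ.+ v))
    add-back = ℤ-Solver.solve-∀
    cancel : ∀ z w v y → ((z ℤ.- w) ℤ.- v) ℤ.+ (y ℤ.+ (w ℤ.+ v)) ≡ z ℤ.+ y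
    cancel = ℤ-Solver.solve-∀
    take-off : ∀ x y w v → x ℤ.- y ≡ (x ℤ.+ (w ℤ.+ v)) ℤ.- (y ℤ.+ (w ℤ.+ v))
    take-off = ℤ-Solver.solve-∀
    uncancel : ∀ z y w v → (z ℤ.+ y) ℤ.- (y ℤ.+ (w ℤ.+ v)) ≡ (z ℤ.- w) ℤ.- v
    uncancel = ℤ-Solver.solve-∀

  beta-shift⇔ : ∀ p s q j b → (+ p ℤ.- + s ≡ (+ q ℤ.- + j) ℤ.- + b) ⇔ (p + (j + b) ≡ q + s)
  beta-shift⇔ p s q j b = ⇔.trans (sub≡sub⇔ (+ p) (+ s) (+ q) (+ j) (+ b))
                                   (mk⇔ (λ eq → ℤ.+-injective (trans lhs (trans eq (sym (ℤ.pos-+ q s)))))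
                                        (λ eq → trans (sym lhs) (trans (cong +_ eq) (ℤ.pos-+ q s))))
    where
    lhs : + (p + (j + b)) ≡ (+ p) ℤ.+ ((+ j) ℤ.+ (+ b))
    lhs = trans (ℤ.pos-+ p (j + b)) (cong (λ u → + p ℤ.+ u) (ℤ.pos-+ j b))

  hook-length⇔ : ∀ {L t k j} b → k ≤ L → j ≤ t → ((L ∸ k) + (t ∸ j) + 1 ≡ b) ⇔ (k + (j + b) ≡ L + suc t)
  hook-length⇔ {k = k} {j} b k≤L j≤t with m≤n⇒∃[o]m+o≡n k≤L | m≤n⇒∃[o]m+o≡n j≤t
  ... | arm , refl | leg , refl rewrite m+n∸m≡n k arm | m+n∸m≡n j leg = mk⇔
    (λ { refl → expand k j arm leg })
    (λ rim → sym (+-cancelˡ-≡ (k + j) b (arm + leg + 1) (trans (+-assoc k j b) (trans rim (regroup k j arm leg)))))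
    where
    expand : ∀ k j arm leg → k + (j + (arm + leg + 1)) ≡ k + arm + suc (j + leg)
    expand = solve-∀
    regroup : ∀ k j arm leg → k + arm + suc (j + leg) ≡ k + j + (arm + leg + 1)
    regroup = solve-∀

  rim-balance : ∀ {k J L t p s} → k + J ≡ L + suc t → p + J ≡ L + s → p + suc t ≡ k + s
  rim-balance {k} {J} {L} {t} {p} {s} rim gap = +-cancelʳ-≡ J (p + suc t) (k + s) (begin
    p + suc t + J    ≡⟨ swap p (suc t) J ⟩
    (p + J) + suc t  ≡⟨ cong (_+ suc t) gap ⟩
    (L + s) + suc t  ≡⟨ swap L s (suc t) ⟩
    (L + suc t) + s  ≡⟨ cong (_+ s) rim ⟨
    (k + J) + s      ≡⟨ swap k J s ⟩
    (k + s) + J      ∎)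
    where
    open ≡-Reasoning
    swap : ∀ x y z → x + y + z ≡ x + z + y
    swap = solve-∀

  no-crossing : ∀ {p t k s} → (k ≤ p) ⇔ (s ≤ t) → p + suc t ≢ k + s
  no-crossing {p} {t} {k} {s} k≤p⇔s≤t eq with s ≤? t
  ... | yes s≤t = <-irrefl (sym eq) (≤-<-trans (+-mono-≤ (from k≤p⇔s≤t s≤t) s≤t) (+-monoʳ-< p (n<1+n t)))
  ... | no  s≰t = <-irrefl eq (+-mono-≤ p<k (≰⇒> s≰t))
    where
    p<k : p < k
    p<k = ≰⇒> (λ k≤p → s≰t (to k≤p⇔s≤t k≤p))

  hook⇒gap : ∀ {l j k b} → Nonincreasing l → InDiagram l j k → hook l j k ≡ b →
             ¬ Beta l ((+ part l j ℤ.- + j) ℤ.- + b)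
  hook⇒gap {l} {j} {k} {b} l↓ (j≥1 , k≥1 , k≤λj) hook≡b (s , s≥1 , x-b≡βs) =
    no-crossing (galois l↓ k≥1 s s≥1) (rim-balance rim gap)
    where
    j≤λ'k : j ≤ conj l k
    j≤λ'k = to (galois l↓ k≥1 j j≥1) k≤λj
    rim : k + (j + b) ≡ part l j + suc (conj l k)
    rim = to (hook-length⇔ b k≤λj j≤λ'k) hook≡b
    gap : part l s + (j + b) ≡ part l j + s
    gap = to (beta-shift⇔ (part l s) s (part l j) j b) (sym x-b≡βs)

  Above : List ℕ → ℕ → ℕ → ℕ → Set
  Above l j b s = part l j + s < part l s + (j + b)

  -- If row t lies above (λ_j - j) - b and row t + 1 strictly below it, then the
  -- cell (j,k) with k = (λ_j - j - b) + t + 1 has hook length b (its leg ends in row t).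
  hook-at-switch : ∀ {l j b t} → Nonincreasing l → 1 ≤ j → j ≤ t → t < j + b →
                   Above l j b t → part l (suc t) + (j + b) < part l j + suc t → HasHook b l
  hook-at-switch {l} {j} {b} {t} l↓ j≥1 j≤t t<j+b above-t below-t+1 =
    j , k , (j≥1 , k≥1 , k≤λj) , from (hook-length⇔ b k≤λj j≤λ'k) rim
    where
    k : ℕ
    k = part l j + suc t ∸ (j + b)
    k-def : k + (j + b) ≡ part l j + suc t
    k-def = m∸n+n≡m (≤-trans (m≤n+m (j + b) (part l (suc t))) (<⇒≤ below-t+1))
    λt+1<k : part l (suc t) < k
    λt+1<k = +-cancelʳ-< (j + b) _ _ (subst (part l (suc t) + (j + b) <_) (sym k-def) below-t+1)
    k≥1 : 1 ≤ k
    k≥1 = ≤-trans (s≤s z≤n) λt+1<k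
    k≤λt : k ≤ part l t
    k≤λt = +-cancelʳ-≤ (j + b) k _
             (subst (_≤ part l t + (j + b)) (trans (sym (+-suc (part l j) t)) (sym k-def)) above-t)
    k≤λj : k ≤ part l j
    k≤λj = +-cancelʳ-≤ (j + b) k _
             (subst (_≤ part l j + (j + b)) (sym k-def) (+-monoʳ-≤ (part l j) t<j+b))
    λ'k≡t : conj l k ≡ t
    λ'k≡t = ≤-antisym
      (≮⇒≥ λ t<λ'k → <⇒≱ λt+1<k (from (galois l↓ k≥1 (suc t) (s≤s z≤n)) t<λ'k))
      (to (galois l↓ k≥1 t (≤-trans j≥1 j≤t)) k≤λt)
    j≤λ'k : j ≤ conj l k
    j≤λ'k = subst (j ≤_) (sym λ'k≡t) j≤t
    rim : k + (j + b) ≡ part l j + suc (conj l k)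
    rim = trans k-def (cong (λ u → part l j + suc u) (sym λ'k≡t))

  above-start : ∀ {l j b} → 1 ≤ b → Above l j b j
  above-start {l} {j} b≥1 = +-monoʳ-< (part l j) (m<m+n j b≥1)

  not-above-end : ∀ {l j b} → Nonincreasing l → 1 ≤ j → ¬ Above l j b (j + b)
  not-above-end {l} {j} {b} l↓ j≥1 = ≤⇒≯ (+-monoˡ-≤ (j + b) (part-antitone l↓ j≥1 (m≤m+n j b)))

  -- A b-gap x = λ_j - j of β(λ) (with b ≥ 1) yields a cell of hook length b:
  -- the last row t ∈ [j, j + b) above x - b is followed by a row strictly below it.
  gap⇒hook : ∀ {l j b} → Nonincreasing l → 1 ≤ b → 1 ≤ j →
             ¬ Beta l ((+ part l j ℤ.- + j) ℤ.- + b) → HasHook b l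
  gap⇒hook {l} {j} {b} l↓ b≥1 j≥1 x-b∉β
    with switch-point (λ s → part l j + s <? part l s + (j + b)) j b
                      (above-start {l} {j} b≥1) (not-above-end l↓ j≥1)
  ... | t , j≤t , t<j+b , above-t , ¬above-t+1 =
    hook-at-switch l↓ j≥1 j≤t t<j+b above-t (≤∧≢⇒< (≮⇒≥ ¬above-t+1) misses-x-b)
    where
    misses-x-b : part l (suc t) + (j + b) ≢ part l j + suc t
    misses-x-b eq =
      x-b∉β (suc t , s≤s z≤n , sym (from (beta-shift⇔ (part l (suc t)) (suc t) (part l j) j b) eq))

  hook⇔gap : ∀ {l b} → Nonincreasing l → 1 ≤ b → HasHook b l ⇔ HasGap (Beta l) b
  hook⇔gap l↓ b≥1 = mk⇔
    (λ (j , k , cell@(j≥1 , _) , hook≡b) → _ , (j , j≥1 , refl) , hook⇒gap l↓ cell hook≡b)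
    (λ { (_ , (j , j≥1 , refl) , x-b∉β) → gap⇒hook l↓ b≥1 j≥1 x-b∉β })

module Abacus (a : ℕ) ⦃ _ : NonZero a ⦄ where
  open import Data.Nat as ℕ using (suc; _/_)
  import Data.Nat.Properties as ℕ
  open import Data.Nat.DivMod using (_mod_; _divMod_; DivMod)
  open import Data.Nat.Divisibility using (_∣_; divides; >⇒∤)
  open import Data.Integer
    using (ℤ; +_; -_; _+_; _-_; _*_; _≤_; _≤?_; 0ℤ; 1ℤ; ∣_∣)
  open import Data.Integer.Properties
    using (+-injective; pos-+; pos-*; abs-*; [+m]-[+n]≡m⊖n; ∣m⊝n∣≤m⊔n; ∣i∣≡0⇒i≡0;
           i-j≡0⇒i≡j; *-cancelʳ-≡; ≤-refl; +-monoˡ-≤; +-monoʳ-≤; neg-mono-≤; module ≤-Reasoning)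
  open import Data.Integer.Tactic.RingSolver using (solve-∀)
  open import Data.Fin using (Fin; toℕ)
  open import Data.Fin.Properties using (toℕ-injective; toℕ<n)
  open import Data.Product using (∃-syntax; _×_; _,_)
  open import Relation.Binary.PropositionalEquality
  open import Relation.Nullary using (¬_; yes; no; contradiction)
  open import Function.Bundles using (_⇔_; mk⇔)
  open Gaps

  -- The bead on runner i at level m of the a-runner abacus (the position m a - i - 1).
  bead : Fin a → ℤ → ℤ
  bead i m = m * + a - + toℕ i - 1ℤ

  Beads : (Fin a → ℤ) → ℤ → Set
  Beads c x = ∃[ i ] ∃[ m ] (m ≤ - c i × x ≡ bead i m)

  multiple-below : ∀ {d} → a ∣ d → d ℕ.< a → d ≡ 0
  multiple-below {0}     _   _   = refl
  multiple-below {suc d} a∣d d<a = contradiction a∣d (>⇒∤ d<a)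

  bead-injective : ∀ {i j m n} → bead i m ≡ bead j n → i ≡ j × m ≡ n
  bead-injective {i} {j} {m} {n} same = toℕ-injective (+-injective (i-j≡0⇒i≡j _ _ i-j≡0)) , m≡n
    where
    iℤ jℤ : ℤ
    iℤ = + toℕ i
    jℤ = + toℕ j
    runner-difference : iℤ - jℤ ≡ (m - n) * + a
    runner-difference = begin
      iℤ - jℤ                                  ≡⟨ expand m n iℤ jℤ (+ a) ⟩
      bead j n - bead i m + (m - n) * + a      ≡⟨ cong (λ u → bead j n - u + (m - n) * + a) same ⟩
      bead j n - bead j n + (m - n) * + a      ≡⟨ collapse (bead j n) ((m - n) * + a) ⟩
      (m - n) * + a                            ∎
      where
      open ≡-Reasoning
      expand : ∀ m n x y A → x - y ≡ (n * A - y - 1ℤ) - (m * A - x - 1ℤ) + (m - n) * A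
      expand = solve-∀
      collapse : ∀ x y → x - x + y ≡ y
      collapse = solve-∀
    a∣∣i-j∣ : a ∣ ∣ iℤ - jℤ ∣
    a∣∣i-j∣ = divides ∣ m - n ∣ (trans (cong ∣_∣ runner-difference) (abs-* (m - n) (+ a)))
    ∣i-j∣<a : ∣ iℤ - jℤ ∣ ℕ.< a
    ∣i-j∣<a = ℕ.≤-<-trans (subst (ℕ._≤ toℕ i ℕ.⊔ toℕ j) (sym (cong ∣_∣ ([+m]-[+n]≡m⊖n (toℕ i) (toℕ j))))
                                    (∣m⊝n∣≤m⊔n (toℕ i) (toℕ j)))
                          (ℕ.⊔-lub (toℕ<n i) (toℕ<n j))
    i-j≡0 : iℤ - jℤ ≡ 0ℤ
    i-j≡0 = ∣i∣≡0⇒i≡0 (multiple-below a∣∣i-j∣ ∣i-j∣<a)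
    m≡n : m ≡ n
    m≡n = i-j≡0⇒i≡j m n (*-cancelʳ-≡ (m - n) 0ℤ (+ a) (trans (sym runner-difference) i-j≡0))

  -- Subtracting b from a position on runner i lands on runner r_a(i + b),
  -- q_a(b + i) levels lower.
  shifted-runner : ℕ → Fin a → Fin a
  shifted-runner b i = (toℕ i ℕ.+ b) mod a

  levels-dropped : ℕ → Fin a → ℕ
  levels-dropped b i = (b ℕ.+ toℕ i) / a

  runner-division : ∀ b i → + toℕ (shifted-runner b i) + + levels-dropped b i * + a ≡ + toℕ i + + b
  runner-division b i = begin
    + r + + q * + a    ≡⟨ cong (λ u → + r + u) (pos-* q a) ⟨
    + r + + (q ℕ.* a)  ≡⟨ pos-+ r (q ℕ.* a) ⟨
    + (r ℕ.+ q ℕ.* a)  ≡⟨ cong +_ division ⟨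
    + (toℕ i ℕ.+ b)    ≡⟨ pos-+ (toℕ i) b ⟩
    + toℕ i + + b      ∎
    where
    open ≡-Reasoning
    r q : ℕ
    r = toℕ (shifted-runner b i)
    q = levels-dropped b i
    division : toℕ i ℕ.+ b ≡ r ℕ.+ q ℕ.* a
    division = trans (DivMod.property ((toℕ i ℕ.+ b) divMod a))
                     (cong (λ u → r ℕ.+ u / a ℕ.* a) (ℕ.+-comm (toℕ i) b))

  bead-shift : ∀ b i m → bead i m - + b ≡ bead (shifted-runner b i) (m - + levels-dropped b i)
  bead-shift b i m = begin
    m * + a - + toℕ i - 1ℤ - + b          ≡⟨ regroup m (+ a) (+ toℕ i) (+ b) ⟩
    m * + a - 1ℤ - (+ toℕ i + + b)        ≡⟨ cong (λ u → m * + a - 1ℤ - u) (runner-division b i) ⟨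
    m * + a - 1ℤ - (+ toℕ r + + q * + a)  ≡⟨ lower m (+ a) (+ toℕ r) (+ q) ⟩
    (m - + q) * + a - + toℕ r - 1ℤ        ∎
    where
    open ≡-Reasoning
    r : Fin a
    r = shifted-runner b i
    q : ℕ
    q = levels-dropped b i
    regroup : ∀ m A x y → m * A - x - 1ℤ - y ≡ m * A - 1ℤ - (x + y)
    regroup = solve-∀
    lower : ∀ m A x y → m * A - 1ℤ - (x + y * A) ≡ (m - y) * A - x - 1ℤ
    lower = solve-∀

  ShiftCondition : (Fin a → ℤ) → ℕ → Fin a → Set
  ShiftCondition c b i = c (shifted-runner b i) - c i ≤ + levels-dropped b i

  drop-below : ∀ {m x y d} → m ≤ - x → y - x ≤ d → m - d ≤ - y
  drop-below {m} {x} {y} {d} m≤-x y-x≤d = begin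
    m - d            ≤⟨ +-monoˡ-≤ (- d) m≤-x ⟩
    - x - d          ≤⟨ +-monoʳ-≤ (- x) (neg-mono-≤ y-x≤d) ⟩
    - x - (y - x)    ≡⟨ simplify x y ⟩
    - y              ∎
    where
    open ≤-Reasoning
    simplify : ∀ x y → - x - (y - x) ≡ - y
    simplify = solve-∀

  drop-below⁻¹ : ∀ {x y d} → - x - d ≤ - y → y - x ≤ d
  drop-below⁻¹ {x} {y} {d} top≤-y = begin
    y - x              ≡⟨ simplify₁ x y ⟩
    - (- y) - x        ≤⟨ +-monoˡ-≤ (- x) (neg-mono-≤ top≤-y) ⟩
    - (- x - d) - x    ≡⟨ simplify₂ x d ⟩
    d                  ∎
    where
    open ≤-Reasoning
    simplify₁ : ∀ x y → y - x ≡ - (- y) - x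
    simplify₁ = solve-∀
    simplify₂ : ∀ x d → - (- x - d) - x ≡ d
    simplify₂ = solve-∀

  -- If the condition fails on runner i, the topmost bead of runner i is a b-gap.
  topmost-bead-gap : ∀ {c b i} → ¬ ShiftCondition c b i → HasGap (Beads c) b
  topmost-bead-gap {c} {b} {i} violated =
    bead i (- c i) , (i , - c i , ≤-refl , refl) , shifted-missing
    where
    shifted-missing : ¬ Beads c (bead i (- c i) - + b)
    shifted-missing (j , m , m≤-cj , at)
      with bead-injective {shifted-runner b i} {j} {(- c i) - + levels-dropped b i} {m}
                          (trans (sym (bead-shift b i (- c i))) at)
    ... | refl , refl = violated (drop-below⁻¹ m≤-cj)

  conditions⇔gap-free : ∀ c b → (∀ i → ShiftCondition c b i) ⇔ (¬ HasGap (Beads c) b)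
  conditions⇔gap-free c b = mk⇔
    (λ { conditions (_ , (i , m , m≤-ci , refl) , shifted-missing) →
           shifted-missing (shifted-runner b i , m - + levels-dropped b i ,
                            drop-below m≤-ci (conditions i) , bead-shift b i m) })
    (λ gap-free i → decide-condition gap-free i)
    where
    decide-condition : ¬ HasGap (Beads c) b → ∀ i → ShiftCondition c b i
    decide-condition gap-free i with c (shifted-runner b i) - c i ≤? + levels-dropped b i
    ... | yes holds    = holds
    ... | no  violated = contradiction (topmost-bead-gap violated) gap-free

open import Data.Nat.DivMod using (_mod_)
open import Data.Integer using (ℤ; +_; _-_; _≤_; 0ℤ)
open import Data.Fin using (Fin; toℕ)
open import Data.List using (List)
open import Relation.Binary.PropositionalEquality using (_≡_)
open import Function.Bundles using (_⇔_)

open import Data.Nat.Base using (>-nonZero⁻¹)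
open import Data.Product using (_,_)
import Function.Properties.Equivalence as ⇔
open Gaps using (¬-cong; HasGap-cong)
open HooksAndGaps using (hook⇔gap)

mainTheorem2 : (a b : ℕ) → {{_ : NonZero a}} → NonZero b →
    (c : Fin a → ℤ) → sumℤ c ≡ 0ℤ →
    (l : List ℕ) → IsCoreOf a c l →
    (IsCore b l ⇔ ((i : Fin a) → c ((toℕ i Data.Nat.+ b) mod a) - c i ≤ + ((b Data.Nat.+ toℕ i) / a)))
mainTheorem2 a b b≢0 c _ l ((_ , l↓) , β⇔beads) =
  ⇔.trans (¬-cong (hook⇔gap l↓ (>-nonZero⁻¹ b {{b≢0}})))
  (⇔.trans (¬-cong (HasGap-cong β⇔beads))
           (⇔.sym (Abacus.conditions⇔gap-free a c b)))
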